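{- Let $d\ge 1$. For every integer $q$ with $2\le q\le d+1$ there exists a frozen $q$-coloring of $\mathbb{Z}^d$.
   Context: $\mathbb{Z}^d$ is regarded as a graph in which two vertices are adjacent iff they differ by a standard unit vector. A $q$-coloring is an assignment of colors from $\{0,\dots,q-1\}$ to vertices so that adjacent vertices receive different colors. A $q$-coloring $x$ of $\mathbb{Z}^d$ is frozen if every $q$-coloring of $\mathbb{Z}^d$ that differs from $x$ on only finitely many vertices is identical to $x$. -}

module Defs where

open import Data.Nat using (ℕ)
open import Data.Fin using (Fin)
open import Data.Integer using (ℤ; _+_; 1ℤ)
open import Data.Product using (Σ; _×_)
open import Data.Sum using (_⊎_)
open import Data.List using (List)
open import Data.List.Membership.Propositional using (_∈_)
open import Relation.Binary.PropositionalEquality using (_≡_; _≢_)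
open import Relation.Nullary using (¬_)

Vertex : ℕ → Set
Vertex d = Fin d → ℤ

Adj : {d : ℕ} → Vertex d → Vertex d → Set
Adj {d} u v = Σ (Fin d) λ i →
  ((v i ≡ u i + 1ℤ) ⊎ (u i ≡ v i + 1ℤ)) × (∀ j → j ≢ i → u j ≡ v j)

Coloring : ℕ → ℕ → Set
Coloring d q = Vertex d → Fin q

IsProper : {d q : ℕ} → Coloring d q → Set
IsProper {d} x = ∀ (u v : Vertex d) → Adj u v → x u ≢ x v

FinitelyDifferent : {d q : ℕ} → Coloring d q → Coloring d q → Set
FinitelyDifferent {d} x y =
  Σ (List (Vertex d)) λ S → ∀ (v : Vertex d) → ¬ (v ∈ S) → x v ≡ y v

IsFrozen : {d q : ℕ} → Coloring d q → Set
IsFrozen {d} {q} x = ∀ (y : Coloring d q) → IsProper y → FinitelyDifferent x y →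
  ∀ (v : Vertex d) → y v ≡ x v

-- Colour v ∈ ℤ^d by h(v) mod q, where h(v) = Σⱼ wⱼ vⱼ and the weights wⱼ ∈ {1,…,q-1}
-- run through 1, 2, …, q-1 on the first q-1 coordinates (this is where q ≤ d+1 is used).
-- Neighbours differ in h by some wⱼ, so the colouring is proper, and the up-neighbours
-- v + eⱼ (j < q-1) of v see every colour but that of v. Hence if y is a proper colouring
-- agreeing with x off a finite set, a downward induction on h, starting above the maximum
-- of h on that set, forces y v = x v everywhere.
module Submission where

open import Defs
open import Data.Nat using (ℕ; _≤_; suc)
open import Data.Product using (Σ; _×_)

import Data.Integer.Properties as ZP
open import Algebra.Properties.CommutativeMonoid.Sum ZP.+-0-commutativeMonoid
  using (sum; sum-remove; sum-cong-≗)
open import Data.Empty using (⊥-elim)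
open import Data.Fin as F using (Fin; toℕ; fromℕ<; punchIn)
import Data.Fin.Properties as FP
open import Data.Integer as Z using (ℤ; +_; -[1+_]; 0ℤ; 1ℤ; +<+; -<+; _%ℕ_; _/ℕ_)
open import Data.Integer.DivMod using (n%ℕd<d; a≡a%ℕn+[a/ℕn]*n)
open import Data.Integer.Tactic.RingSolver using (solve-∀)
open import Data.List using (List; map)
open import Data.List.Extrema ZP.≤-totalOrder using (max; xs≤max)
open import Data.List.Membership.Propositional using (_∈_)
import Data.List.Relation.Unary.All as All
open import Data.List.Relation.Unary.All.Properties using (map⁻)
open import Data.Nat as N using (zero; z≤n; s≤s; NonZero; _⊓_; _%_; _/_)
open import Data.Nat.DivMod using (m<n⇒m%n≡m; [m+n]%n≡m%n; m≡m%n+[m/n]*n; m%n<n)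
import Data.Nat.Properties as NP
import Data.Nat.Tactic.RingSolver as ℕ-Ring
open import Data.Product using (_,_; ∃-syntax)
open import Data.Sum using (_⊎_; inj₁; inj₂)
open import Data.Vec.Functional using (removeAt; updateAt)
open import Data.Vec.Functional.Properties using (updateAt-updates; updateAt-minimal)
open import Relation.Binary.Definitions using (tri<; tri≈; tri>)
open import Relation.Binary.PropositionalEquality
open import Relation.Nullary using (yes; no)

private
  variable
    A : Set
    d q : ℕ

[m+n]%d≢m : ∀ m {n d} .{{_ : NonZero d}} → 0 N.< n → n N.< d → (m N.+ n) % d ≢ m
[m+n]%d≢m m {n} {d} 0<n n<d eq = not-multiple ((m N.+ n) / d) n≡kd
  where
  n≡kd : n ≡ (m N.+ n) / d N.* d
  n≡kd = NP.+-cancelˡ-≡ m n _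
           (trans (m≡m%n+[m/n]*n (m N.+ n) d) (cong (N._+ (m N.+ n) / d N.* d) eq))
  not-multiple : ∀ k → n ≢ k N.* d
  not-multiple zero    n≡0    = NP.<⇒≢ 0<n (sym n≡0)
  not-multiple (suc k) n≡d+kd = NP.<⇒≱ n<d (subst (d N.≤_) (sym n≡d+kd) (NP.m≤m+n d _))

[m+n]%d-onto : ∀ {r c d} .{{_ : NonZero d}} → r N.< d → c N.< d → c ≢ r →
               ∃[ t ] suc t N.< d × (r N.+ suc t) % d ≡ c
[m+n]%d-onto {r} {c} {d} r<d c<d c≢r with NP.<-cmp r c
... | tri≈ _ r≡c _ = ⊥-elim (c≢r (sym r≡c))
... | tri< r<c _ _ with t , refl ← NP.m≤n⇒∃[o]m+o≡n r<c =
  t , NP.≤-<-trans (s≤s (NP.m≤n+m t r)) c<d ,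
  trans (cong (_% d) (NP.+-suc r t)) (m<n⇒m%n≡m c<d)
... | tri> _ _ c<r with t , refl ← NP.m≤n⇒∃[o]m+o≡n c<r
                   with u , refl ← NP.m≤n⇒∃[o]m+o≡n (NP.≤-trans (s≤s (s≤s (NP.m≤n+m t c))) r<d) =
  u , s≤s (s≤s (NP.m≤n+m u t)) , (begin
    (suc c N.+ t N.+ suc u) % d  ≡⟨ cong (_% d) (wraps-around c t u) ⟩
    (c N.+ d) % d                ≡⟨ [m+n]%n≡m%n c d ⟩
    c % d                        ≡⟨ m<n⇒m%n≡m c<d ⟩
    c                            ∎)
  where
  open ≡-Reasoning
  wraps-around : ∀ c t u → suc c N.+ t N.+ suc u ≡ c N.+ (suc (suc t) N.+ u)
  wraps-around = ℕ-Ring.solve-∀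

+r≢+r′+[1+k]*n : ∀ {r r′ k n} → r N.< n → + r ≢ + r′ Z.+ + suc k Z.* + n
+r≢+r′+[1+k]*n {r} {r′} {k} {n} r<n eq =
  NP.<⇒≱ r<n (subst (n N.≤_) (sym r≡r′+n+kn) (NP.≤-trans (NP.m≤m+n n _) (NP.m≤n+m _ r′)))
  where
  r≡r′+n+kn : r ≡ r′ N.+ suc k N.* n
  r≡r′+n+kn = ZP.+-injective (begin
    + r                          ≡⟨ eq ⟩
    + r′ Z.+ + suc k Z.* + n     ≡⟨ cong (Z._+_ (+ r′)) (sym (ZP.pos-* (suc k) n)) ⟩
    + r′ Z.+ + (suc k N.* n)     ≡⟨ sym (ZP.pos-+ r′ _) ⟩
    + (r′ N.+ suc k N.* n)       ∎)
    where open ≡-Reasoning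

+r≡+r′+δ*n⇒r≡r′ : ∀ {r r′ n} δ → r N.< n → r′ N.< n → + r ≡ + r′ Z.+ δ Z.* + n → r ≡ r′
+r≡+r′+δ*n⇒r≡r′ {r′ = r′} (+ zero) _ _ eq = trans (ZP.+-injective eq) (NP.+-identityʳ r′)
+r≡+r′+δ*n⇒r≡r′ (+ suc k) r<n _ eq = ⊥-elim (+r≢+r′+[1+k]*n {k = k} r<n eq)
+r≡+r′+δ*n⇒r≡r′ {r} {r′} {n} -[1+ k ] _ r′<n eq =
  ⊥-elim (+r≢+r′+[1+k]*n {k = k} r′<n (begin
    + r′                                          ≡⟨ undo (+ r′) -[1+ k ] (+ n) ⟩
    + r′ Z.+ -[1+ k ] Z.* + n Z.+ + suc k Z.* + n ≡⟨ cong (Z._+ + suc k Z.* + n) (sym eq) ⟩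
    + r Z.+ + suc k Z.* + n                       ∎))
  where
  open ≡-Reasoning
  undo : ∀ i δ m → i ≡ i Z.+ δ Z.* m Z.+ (Z.- δ) Z.* m
  undo = solve-∀

%ℕ-unique : ∀ {i r k n} .{{_ : NonZero n}} → r N.< n → i ≡ + r Z.+ k Z.* + n → i %ℕ n ≡ r
%ℕ-unique {i} {r} {k} {n} r<n eq = +r≡+r′+δ*n⇒r≡r′ (k Z.- i /ℕ n) (n%ℕd<d i n) r<n (begin
  + (i %ℕ n)                         ≡⟨ add-sub (+ (i %ℕ n)) (i /ℕ n) (+ n) ⟩
  + (i %ℕ n) Z.+ kᵢ*n Z.- kᵢ*n       ≡⟨ cong (Z._- kᵢ*n) (trans (sym (a≡a%ℕn+[a/ℕn]*n i n)) eq) ⟩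
  + r Z.+ k Z.* + n Z.- kᵢ*n         ≡⟨ collect (+ r) k (i /ℕ n) (+ n) ⟩
  + r Z.+ (k Z.- i /ℕ n) Z.* + n     ∎)
  where
  open ≡-Reasoning
  kᵢ*n : ℤ
  kᵢ*n = i /ℕ n Z.* + n
  add-sub : ∀ a b m → a ≡ a Z.+ b Z.* m Z.- b Z.* m
  add-sub = solve-∀
  collect : ∀ a b c m → a Z.+ b Z.* m Z.- c Z.* m ≡ a Z.+ (b Z.- c) Z.* m
  collect = solve-∀

[i+n]%ℕd≡[i%ℕd+n]%d : ∀ i n {d} .{{_ : NonZero d}} → (i Z.+ + n) %ℕ d ≡ (i %ℕ d N.+ n) % d
[i+n]%ℕd≡[i%ℕd+n]%d i n {d} = %ℕ-unique {k = k Z.+ j} (m%n<n (r N.+ n) d) (begin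
  i Z.+ + n                        ≡⟨ cong (Z._+ + n) (a≡a%ℕn+[a/ℕn]*n i d) ⟩
  + r Z.+ k Z.* + d Z.+ + n        ≡⟨ swap (+ r) (k Z.* + d) (+ n) ⟩
  + r Z.+ + n Z.+ k Z.* + d        ≡⟨ cong (Z._+ k Z.* + d) (sym (ZP.pos-+ r n)) ⟩
  + (r N.+ n) Z.+ k Z.* + d        ≡⟨ cong (Z._+ k Z.* + d) (a≡a%ℕn+[a/ℕn]*n (+ (r N.+ n)) d) ⟩
  + s Z.+ j Z.* + d Z.+ k Z.* + d  ≡⟨ collect (+ s) j k (+ d) ⟩
  + s Z.+ (k Z.+ j) Z.* + d        ∎)
  where
  open ≡-Reasoning
  r = i %ℕ d
  k = i /ℕ d
  s = (r N.+ n) % d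
  j = + (r N.+ n) /ℕ d
  swap : ∀ a b c → a Z.+ b Z.+ c ≡ a Z.+ c Z.+ b
  swap = solve-∀
  collect : ∀ a b c m → a Z.+ b Z.* m Z.+ c Z.* m ≡ a Z.+ (c Z.+ b) Z.* m
  collect = solve-∀

residue : (n : ℕ) .{{_ : NonZero n}} → ℤ → Fin n
residue n i = fromℕ< (n%ℕd<d i n)

toℕ-residue : ∀ n .{{_ : NonZero n}} i → toℕ (residue n i) ≡ i %ℕ n
toℕ-residue n i = FP.toℕ-fromℕ< (n%ℕd<d i n)

residue-+-≢ : ∀ n .{{_ : NonZero n}} i {t} → suc t N.< n →
              residue n (i Z.+ + suc t) ≢ residue n i
residue-+-≢ n i {t} 1+t<n eq = [m+n]%d≢m (i %ℕ n) (s≤s z≤n) 1+t<n (begin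
  (i %ℕ n N.+ suc t) % n           ≡⟨ sym ([i+n]%ℕd≡[i%ℕd+n]%d i (suc t)) ⟩
  (i Z.+ + suc t) %ℕ n             ≡⟨ sym (toℕ-residue n (i Z.+ + suc t)) ⟩
  toℕ (residue n (i Z.+ + suc t))  ≡⟨ cong toℕ eq ⟩
  toℕ (residue n i)                ≡⟨ toℕ-residue n i ⟩
  i %ℕ n                           ∎)
  where open ≡-Reasoning

residue-+-onto : ∀ n .{{_ : NonZero n}} i {c} → c ≢ residue n i →
                 ∃[ t ] suc t N.< n × residue n (i Z.+ + suc t) ≡ c
residue-+-onto n i {c} c≢ri
  with t , 1+t<n , eq ← [m+n]%d-onto (n%ℕd<d i n) (FP.toℕ<n c)
      (λ c≡r → c≢ri (FP.toℕ-injective (trans c≡r (sym (toℕ-residue n i))))) =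
  t , 1+t<n , FP.toℕ-injective (begin
    toℕ (residue n (i Z.+ + suc t))  ≡⟨ toℕ-residue n (i Z.+ + suc t) ⟩
    (i Z.+ + suc t) %ℕ n             ≡⟨ [i+n]%ℕd≡[i%ℕd+n]%d i (suc t) ⟩
    (i %ℕ n N.+ suc t) % n           ≡⟨ eq ⟩
    toℕ c                            ∎)
  where open ≡-Reasoning

UnitStep : Fin d → Vertex d → Vertex d → Set
UnitStep i u v = v i ≡ u i Z.+ 1ℤ × (∀ j → j ≢ i → u j ≡ v j)

UnitStep⇒Adj : ∀ {i} {u v : Vertex d} → UnitStep i u v → Adj u v
UnitStep⇒Adj {i = i} (vᵢ≡uᵢ+1 , rest) = i , inj₁ vᵢ≡uᵢ+1 , rest

Adj⇒UnitStep : {u v : Vertex d} → Adj u v → ∃[ i ] (UnitStep i u v ⊎ UnitStep i v u)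
Adj⇒UnitStep (i , inj₁ vᵢ≡uᵢ+1 , rest) = i , inj₁ (vᵢ≡uᵢ+1 , rest)
Adj⇒UnitStep (i , inj₂ uᵢ≡vᵢ+1 , rest) = i , inj₂ (uᵢ≡vᵢ+1 , λ j j≢i → sym (rest j j≢i))

_+e_ : Vertex d → Fin d → Vertex d
v +e i = updateAt v i (Z._+ 1ℤ)

UnitStep-+e : (v : Vertex d) (i : Fin d) → UnitStep i v (v +e i)
UnitStep-+e v i = updateAt-updates i v , λ j j≢i → sym (updateAt-minimal j i v j≢i)

_·_ : (Fin d → ℤ) → Vertex d → ℤ
w · v = sum (λ j → w j Z.* v j)

·-UnitStep : ∀ (w : Fin d → ℤ) {i u v} → UnitStep i u v → w · v ≡ w · u Z.+ w i
·-UnitStep {suc d} w {i} {u} {v} (vᵢ≡uᵢ+1 , rest) = begin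
  w · v                                       ≡⟨ sum-remove {i = i} wv ⟩
  w i Z.* v i Z.+ sum (removeAt wv i)         ≡⟨ cong₂ Z._+_ (cong (w i Z.*_) vᵢ≡uᵢ+1)
                                                   (sum-cong-≗ same-off-i) ⟩
  w i Z.* (u i Z.+ 1ℤ) Z.+ sum (removeAt wu i) ≡⟨ expand (w i) (u i) _ ⟩
  w i Z.* u i Z.+ sum (removeAt wu i) Z.+ w i ≡⟨ cong (Z._+ w i) (sym (sum-remove {i = i} wu)) ⟩
  w · u Z.+ w i                               ∎
  where
  open ≡-Reasoning
  wv wu : Fin (suc d) → ℤ
  wv j = w j Z.* v j
  wu j = w j Z.* u j
  same-off-i : ∀ j → removeAt wv i j ≡ removeAt wu i j
  same-off-i j = cong (w (punchIn i j) Z.*_) (sym (rest (punchIn i j) (FP.punchInᵢ≢i i j)))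
  expand : ∀ a b c → a Z.* (b Z.+ 1ℤ) Z.+ c ≡ a Z.* b Z.+ c Z.+ a
  expand = solve-∀

bounded-on-list : (f : A → ℤ) (S : List A) → ∃[ M ] (∀ {a} → a ∈ S → f a Z.≤ M)
bounded-on-list f S = max 0ℤ (map f S) , All.lookup (map⁻ (xs≤max 0ℤ (map f S)))

∃[k]i<j+k : ∀ i j → ∃[ k ] i Z.< j Z.+ + k
∃[k]i<j+k i j = suc Z.∣ i Z.- j ∣ , (begin-strict
  i                           ≡⟨ split i j ⟩
  j Z.+ (i Z.- j)             <⟨ ZP.+-monoʳ-< j (i<1+∣i∣ (i Z.- j)) ⟩
  j Z.+ + suc Z.∣ i Z.- j ∣   ∎)
  where
  open ZP.≤-Reasoning
  split : ∀ i j → i ≡ j Z.+ (i Z.- j)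
  split = solve-∀
  i<1+∣i∣ : ∀ i → i Z.< + suc Z.∣ i ∣
  i<1+∣i∣ (+ n)    = +<+ (NP.n<1+n n)
  i<1+∣i∣ -[1+ n ] = -<+

m<i+[1+k]⇒m<j+k : ∀ {i j m} k → i Z.< j → m Z.< i Z.+ + suc k → m Z.< j Z.+ + k
m<i+[1+k]⇒m<j+k {i} {j} {m} k i<j m<i+1+k = begin-strict
  m                   <⟨ m<i+1+k ⟩
  i Z.+ (1ℤ Z.+ + k)  ≡⟨ regroup i (+ k) ⟩
  Z.suc i Z.+ + k     ≤⟨ ZP.+-monoˡ-≤ (+ k) (ZP.i<j⇒suc[i]≤j i<j) ⟩
  j Z.+ + k           ∎
  where
  open ZP.≤-Reasoning
  regroup : ∀ i k → i Z.+ (1ℤ Z.+ k) ≡ 1ℤ Z.+ i Z.+ k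
  regroup = solve-∀

AllOtherColoursAbove : (Vertex d → ℤ) → Coloring d q → Set
AllOtherColoursAbove h x = ∀ v c → c ≢ x v → ∃[ w ] Adj v w × h v Z.< h w × x w ≡ c

agreement-propagates-down : (h : Vertex d → ℤ) {x y : Coloring d q} →
                            AllOtherColoursAbove h x → IsProper y →
                            ∀ M → (∀ v → M Z.< h v → y v ≡ x v) → ∀ v → y v ≡ x v
agreement-propagates-down h {x} {y} above y-proper M agree-above v =
  let k , M<hv+k = ∃[k]i<j+k M (h v) in agree k v M<hv+k
  where
  agree : ∀ k v → M Z.< h v Z.+ + k → y v ≡ x v
  agree zero v M<hv+0 = agree-above v (subst (M Z.<_) (ZP.+-identityʳ (h v)) M<hv+0)
  agree (suc k) v M<hv+1+k with y v F.≟ x v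
  ... | yes yv≡xv = yv≡xv
  ... | no yv≢xv with w , v~w , hv<hw , xw≡yv ← above v (y v) yv≢xv =
    ⊥-elim (y-proper v w v~w (sym (trans (agree k w (m<i+[1+k]⇒m<j+k k hv<hw M<hv+1+k)) xw≡yv)))

allOtherColoursAbove⇒frozen : (h : Vertex d → ℤ) {x : Coloring d q} →
                              AllOtherColoursAbove h x → IsFrozen x
allOtherColoursAbove⇒frozen h above y y-proper (S , agree) =
  let M , h≤M = bounded-on-list h S in
  agreement-propagates-down h above y-proper M
    (λ v M<hv → sym (agree v (λ v∈S → ZP.<⇒≱ M<hv (h≤M v∈S))))

module Stripes (m : ℕ) where

  weight : Fin d → ℤ
  weight j = + suc (toℕ j ⊓ m)

  height : Vertex d → ℤ
  height = weight ·_

  stripes : Coloring d (suc (suc m))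
  stripes v = residue (suc (suc m)) (height v)

  stripes-proper : IsProper {d} stripes
  stripes-proper u v u~v with i , step ← Adj⇒UnitStep u~v = either step
    where
    weight<q : ∀ i → suc (toℕ i ⊓ m) N.< suc (suc m)
    weight<q i = s≤s (s≤s (NP.m⊓n≤n (toℕ i) m))
    differ : ∀ {i u v} → UnitStep i u v → stripes u ≢ stripes v
    differ {i} {u} step eq = residue-+-≢ _ (height u) (weight<q i)
      (trans (cong (residue _) (sym (·-UnitStep weight step))) (sym eq))
    either : UnitStep i u v ⊎ UnitStep i v u → stripes u ≢ stripes v
    either (inj₁ u→v)    = differ u→v
    either (inj₂ v→u) eq = differ v→u (sym eq)

  stripes-allOtherColoursAbove : suc m N.≤ d → AllOtherColoursAbove height (stripes {d})
  stripes-allOtherColoursAbove {d} 1+m≤d v c c≢xv =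
    neighbour (residue-+-onto (suc (suc m)) (height v) c≢xv)
    where
    neighbour : ∃[ t ] suc t N.< suc (suc m) × residue (suc (suc m)) (height v Z.+ + suc t) ≡ c →
                ∃[ w ] Adj v w × height v Z.< height w × stripes w ≡ c
    neighbour (t , 1+t<q , colour) =
      v +e i , UnitStep⇒Adj (UnitStep-+e v i) , height-grows ,
      trans (cong (residue (suc (suc m))) height-step) colour
      where
      t≤m : t N.≤ m
      t≤m = NP.≤-pred (NP.≤-pred 1+t<q)
      t<d : t N.< d
      t<d = NP.<-≤-trans (s≤s t≤m) 1+m≤d
      i : Fin d
      i = fromℕ< t<d
      weight-i : weight i ≡ + suc t
      weight-i = cong (λ k → + suc k)
                   (trans (cong (_⊓ m) (FP.toℕ-fromℕ< t<d)) (NP.m≤n⇒m⊓n≡m t≤m))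
      height-step : height (v +e i) ≡ height v Z.+ + suc t
      height-step = trans (·-UnitStep weight (UnitStep-+e v i)) (cong (Z._+_ (height v)) weight-i)
      height-grows : height v Z.< height (v +e i)
      height-grows = subst₂ Z._<_ (ZP.+-identityʳ (height v)) (sym height-step)
                       (ZP.+-monoʳ-< (height v) (+<+ (s≤s z≤n)))

proposition2p1 : (d : ℕ) → 1 ≤ d → (q : ℕ) → 2 ≤ q → q ≤ suc d →
    Σ (Coloring d q) λ x → IsProper x × IsFrozen x
proposition2p1 d _ (suc zero)    (s≤s ()) _
proposition2p1 d _ (suc (suc m)) _        (s≤s 1+m≤d) =
  stripes , stripes-proper ,
  allOtherColoursAbove⇒frozen height (stripes-allOtherColoursAbove 1+m≤d)
  where open Stripes m
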